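{- Let $H=(\mathcal{V},\mathcal{I})$ be an interval hypergraph that is not proper, and suppose that after the colouring step of Algorithm isEHS no interval of $\mathcal{I}$ has all its points black, so that the reduced hypergraph $H'=(\mathcal{V}',\mathcal{I}')$ is constructed. Then $H$ is exactly hittable if and only if $H'$ is exactly hittable.
   Context: An interval hypergraph is $H=(\mathcal{V},\mathcal{I})$ with $\mathcal{V}$ a finite linearly ordered point set (e.g. $[n]$) and $\mathcal{I}$ a set of hyperedges each consisting of consecutive points (intervals), with left and right end points $l(I),r(I)$. $H$ is proper if no hyperedge is contained in a different hyperedge. A hypergraph is exactly hittable if there is a set of vertices meeting every hyperedge in exactly one vertex. Colouring step of Algorithm isEHS: colour all points white; for every pair of intervals $I_i,I_j\in\mathcal{I}$ with $I_j\subseteq I_i$ (i.e. $l(I_j)\ge l(I_i)$, $r(I_j)\le r(I_i)$), colour every point of $I_i\setminus I_j$ black. The reduced hypergraph $H'$ has vertex set $\mathcal{V}'$ = the white points (with inherited order) and hyperedge set $\mathcal{I}'$ consisting of the sets $I\cap\mathcal{V}'$ for $I\in\mathcal{I}$, keeping only one among hyperedges having the same left and right end points. -}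

module Defs where

open import Data.Nat using (ℕ; _≤_; _<_)
open import Data.Product using (Σ; _×_; ∃; ∃-syntax; ∃!)
open import Data.List using (List; map)
open import Data.List.Relation.Unary.All using (All)
open import Data.List.Membership.Propositional using (_∈_)
open import Relation.Nullary using (¬_)
open import Relation.Binary.PropositionalEquality using (_≡_)

record Hypergraph : Set₁ where
  field
    V : ℕ → Set
    E : List (ℕ → Set)

ExactlyHittable : Hypergraph → Set₁
ExactlyHittable H =
  Σ (ℕ → Set) λ S →
    (∀ x → S x → Hypergraph.V H x) ×
    All (λ e → ∃! _≡_ (λ x → S x × e x)) (Hypergraph.E H)

record Interval : Set where
  constructor ⟦_,_⟧⟨_⟩
  field
    l : ℕ
    r : ℕ
    l≤r : l ≤ r
open Interval public

_∈I_ : ℕ → Interval → Set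
x ∈I I = l I ≤ x × x ≤ r I

_⊆I_ : Interval → Interval → Set
J ⊆I I = l I ≤ l J × r J ≤ r I

-- Interval hypergraph on the point set [n] = {0,…,n-1}.
record IntervalHypergraph : Set where
  field
    n     : ℕ
    edges : List Interval
    inRange : All (λ I → r I < n) edges
open IntervalHypergraph public

toHypergraph : IntervalHypergraph → Hypergraph
toHypergraph H = record { V = λ x → x < n H ; E = map (λ I x → x ∈I I) (edges H) }

Proper : IntervalHypergraph → Set
Proper H = ∀ I J → I ∈ edges H → J ∈ edges H → J ⊆I I →
           l I ≡ l J × r I ≡ r J

-- Colouring step of isEHS: x is black iff x ∈ I ∖ J for some I, J ∈ 𝓘 with J ⊆ I.
Black : IntervalHypergraph → ℕ → Set
Black H x = ∃[ I ] ∃[ J ] (I ∈ edges H × J ∈ edges H × J ⊆I I × x ∈I I × ¬ (x ∈I J))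

White : IntervalHypergraph → ℕ → Set
White H x = x < n H × ¬ Black H x

NoAllBlackInterval : IntervalHypergraph → Set
NoAllBlackInterval H = ∀ I → I ∈ edges H → ¬ (∀ x → x ∈I I → Black H x)

-- Reduced hypergraph H' : vertices = white points, hyperedges = I ∩ 𝓥'.
-- (Removal of duplicate hyperedges with the same end points is not performed:
--  as a list of sets, duplicates represent the same hyperedge set.)
reduced : IntervalHypergraph → Hypergraph
reduced H = record
  { V = White H
  ; E = map (λ I x → x ∈I I × White H x) (edges H)
  }

module Submission where

-- The argument rests on two facts.
--  * An exact hitting set S of H contains no black point.  If x ∈ I ∖ J with
--    J ⊆ I, then S meets J in some point b, which also lies in I; since S meets
--    I only once, x = b ∈ J, a contradiction.  Hence S lies inside the white
--    point set 𝓥'.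
--  * For any set S contained in a set W, S meets a hyperedge e exactly once
--    iff it meets e ∩ W exactly once, since S ∩ e = S ∩ (e ∩ W).
-- Forward: an exact hitting set of H lies in 𝓥' by the first fact, and then
-- hits every I ∩ 𝓥' exactly once by the second.  Backward: an exact hitting set
-- of H' lies in 𝓥' by definition, so the second fact transfers it back to H.
-- The hypotheses that H is not proper and that no interval is all black only
-- guarantee that the algorithm builds H'; the equivalence holds without them.

open import Defs
open import Relation.Nullary using (¬_)
open import Function.Base using (_∘_)
open import Function.Bundles using (_⇔_; mk⇔; Equivalence)
open import Data.Nat using (ℕ)
open import Data.Nat.Properties using (≤-trans)
open import Data.Product using (_×_; _,_; proj₁; ∃!)
open import Data.List.Relation.Unary.All as All using (All)
open import Data.List.Relation.Unary.All.Properties using (map⁺; map⁻)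
open import Relation.Binary.PropositionalEquality using (_≡_; sym; trans; subst)

MeetsOnce : (ℕ → Set) → (ℕ → Set) → Set
MeetsOnce S e = ∃! _≡_ (λ x → S x × e x)

-- Restricting a hyperedge to a superset W of S does not change S ∩ e, so
-- exact hitting is preserved in both directions.
meetsOnce-restrict : {S W : ℕ → Set} (e : ℕ → Set) → (∀ x → S x → W x) →
                     MeetsOnce S e ⇔ MeetsOnce S (λ x → e x × W x)
meetsOnce-restrict {S} {W} e S⊆W = mk⇔ restrict extend
  where
  restrict : MeetsOnce S e → MeetsOnce S (λ x → e x × W x)
  restrict (x , (Sx , ex) , unique) =
    x , (Sx , ex , S⊆W x Sx) , λ (Sy , ey , _) → unique (Sy , ey)

  extend : MeetsOnce S (λ x → e x × W x) → MeetsOnce S e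
  extend (x , (Sx , ex , _) , unique) =
    x , (Sx , ex) , λ {y} (Sy , ey) → unique (Sy , ey , S⊆W y Sy)

⊆I-∈I : ∀ {x I J} → J ⊆I I → x ∈I J → x ∈I I
⊆I-∈I (lI≤lJ , rJ≤rI) (lJ≤x , x≤rJ) = ≤-trans lI≤lJ lJ≤x , ≤-trans x≤rJ rJ≤rI

-- If S meets both I and a sub-interval J ⊆ I exactly once, then S ∩ I lies
-- in J: the point of S in J is also in I, so it is the only point of S in I.
meetsOnce-sub-interval : ∀ {S : ℕ → Set} {I J x} →
                         MeetsOnce S (_∈I I) → MeetsOnce S (_∈I J) → J ⊆I I →
                         S x → x ∈I I → x ∈I J
meetsOnce-sub-interval {I = I} {J} {x} (_ , _ , uniqueI) (b , (Sb , bJ) , _) J⊆I Sx xI =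
  subst (_∈I J) b≡x bJ
  where
  b≡x : b ≡ x
  b≡x = trans (sym (uniqueI (Sb , ⊆I-∈I {b} {I} {J} J⊆I bJ))) (uniqueI (Sx , xI))

exact-hitting-avoids-black : (H : IntervalHypergraph) {S : ℕ → Set} →
                             All (λ I → MeetsOnce S (_∈I I)) (edges H) →
                             ∀ x → S x → ¬ Black H x
exact-hitting-avoids-black H {S} hits x Sx (I , J , I∈ , J∈ , J⊆I , xI , x∉J) =
  x∉J (meetsOnce-sub-interval {S} {I} {J} {x}
         (All.lookup hits I∈) (All.lookup hits J∈) J⊆I Sx xI)

lemma11 : (H : IntervalHypergraph) → ¬ Proper H → NoAllBlackInterval H →
          ExactlyHittable (toHypergraph H) ⇔ ExactlyHittable (reduced H)
lemma11 H _ _ = mk⇔ to-reduced from-reduced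
  where
  to-reduced : ExactlyHittable (toHypergraph H) → ExactlyHittable (reduced H)
  to-reduced (S , S⊆V , hitsH) =
    S , S⊆White ,
    map⁺ {f = λ I x → x ∈I I × White H x} (All.map (λ {I} → restrict {I}) hits)
    where
    hits : All (λ I → MeetsOnce S (_∈I I)) (edges H)
    hits = map⁻ hitsH
    S⊆White : ∀ x → S x → White H x
    S⊆White x Sx = S⊆V x Sx , exact-hitting-avoids-black H hits x Sx
    restrict : ∀ {I} → MeetsOnce S (_∈I I) → MeetsOnce S (λ x → x ∈I I × White H x)
    restrict {I} = Equivalence.to (meetsOnce-restrict (_∈I I) S⊆White)

  from-reduced : ExactlyHittable (reduced H) → ExactlyHittable (toHypergraph H)
  from-reduced (S , S⊆White , hitsH') =
    S , (λ x → proj₁ ∘ S⊆White x) ,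
    map⁺ {f = λ I x → x ∈I I} (All.map (λ {I} → extend {I}) hits')
    where
    hits' : All (λ I → MeetsOnce S (λ x → x ∈I I × White H x)) (edges H)
    hits' = map⁻ {f = λ I x → x ∈I I × White H x} hitsH'
    extend : ∀ {I} → MeetsOnce S (λ x → x ∈I I × White H x) → MeetsOnce S (_∈I I)
    extend {I} = Equivalence.from (meetsOnce-restrict (_∈I I) S⊆White)
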